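{- For all $n\ge1$, $a_{n,2,00}=1+\binom{n}{2}$.
   Context: For a finite integer sequence $(a_1,\dots,a_i)$, $\mathrm{asc}(a_1,\dots,a_i)=|\{j:1\le j<i,\ a_j<a_{j+1}\}|$. For an integer $p\ge1$, a $p$-ascent sequence of length $n\ge1$ is a sequence $(a_1,\dots,a_n)$ of nonnegative integers with $a_1=0$ and $a_i\le p+\mathrm{asc}(a_1,\dots,a_{i-1})$ for all $2\le i\le n$. $a_{n,p,00}$ is the number of $p$-ascent sequences of length $n$ avoiding the pattern $00$, i.e. having all letters distinct. -}

module Defs where

open import Data.Nat using (ℕ; zero; suc; _+_; _<_; _≤_; _<ᵇ_; _≤ᵇ_)
open import Data.Bool using (Bool; true; false; _∧_; if_then_else_)
open import Data.List using (List; []; _∷_; length; filter; map; concatMap; upTo; reverse)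
open import Relation.Nullary using (Dec; yes; no)
open import Relation.Unary using (Decidable)
open import Data.Nat.Properties using (_≟_)
open import Data.List.Relation.Unary.Unique.DecPropositional _≟_ using (unique?)
open import Data.Bool using (T)
open import Data.Unit using (⊤; tt)
open import Data.Empty using (⊥)

asc : List ℕ → ℕ
asc [] = 0
asc (x ∷ []) = 0
asc (x ∷ y ∷ xs) = (if x <ᵇ y then 1 else 0) + asc (y ∷ xs)

ascOKFrom : ℕ → List ℕ → List ℕ → Bool
ascOKFrom p pre [] = true
ascOKFrom p pre (x ∷ xs) = (x ≤ᵇ p + asc pre) ∧ ascOKFrom p (pre Data.List.++ (x ∷ [])) xs

-- p-ascent sequence: a_1 = 0 and a_i ≤ p + asc(a_1,…,a_{i-1}) for 2 ≤ i ≤ n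
IsAscentSeq : ℕ → List ℕ → Set
IsAscentSeq p [] = ⊥
IsAscentSeq p (zero ∷ xs) = T (ascOKFrom p (zero ∷ []) xs)
IsAscentSeq p (suc _ ∷ xs) = ⊥

isAscentSeq? : (p : ℕ) (xs : List ℕ) → Dec (IsAscentSeq p xs)
isAscentSeq? p [] = no (λ ())
isAscentSeq? p (zero ∷ xs) with ascOKFrom p (zero ∷ []) xs
... | true = yes tt
... | false = no (λ ())
isAscentSeq? p (suc _ ∷ xs) = no (λ ())

allSeqs : ℕ → ℕ → List (List ℕ)
allSeqs b zero = [] ∷ []
allSeqs b (suc n) = concatMap (λ x → map (x ∷_) (allSeqs b n)) (upTo b)

-- Every p-ascent sequence of length n has entries ≤ p + (n - 2) < p + n,
-- so filtering allSeqs (p + n) n yields exactly the p-ascent sequences of length n.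
ascentSeqs : ℕ → ℕ → List (List ℕ)
ascentSeqs p n = filter (isAscentSeq? p) (allSeqs (p + n) n)

-- a_{n,p,00}: number of p-ascent sequences of length n avoiding 00 (all letters distinct)
a00 : ℕ → ℕ → ℕ
a00 n p = length (filter unique? (ascentSeqs p n))

-- A 2-ascent sequence with distinct letters is read left to right by an automaton
-- whose state is the number a of ascents so far, the last letter and the set of
-- letters used; the next letter must be a fresh letter ≤ a + 2. Starting from the
-- sequence 0, only three kinds of states are reachable:
--   interval:  used 0..a, last letter a                      — next letter a+1 or a+2;
--   gap:       used 0..a+1 except one m ≤ a, last letter a+1 — next letter m or a+2;
--   saturated: used 0..a+1                                   — next letter a+2.
-- A saturated state has one continuation of each length, a gap state k+1 of length k,
-- and an interval state 1 + C(k+1,2) (by Pascal's rule), giving a_{n,2,00} = 1 + C(n,2).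
module Submission where

open import Defs
open import Algebra.Bundles using (CommutativeMonoid)
open import Data.Bool using (Bool; true; false; not; _∧_; _∨_; if_then_else_)
open import Data.Bool.ListAction using (all)
open import Data.Bool.Properties using (∧-zeroʳ; ∨-identityʳ; ∧-assoc; ∧-commutativeMonoid)
open import Algebra.Properties.CommutativeSemigroup (CommutativeMonoid.commutativeSemigroup ∧-commutativeMonoid)
  using (interchange)
open import Data.List using (List; []; _∷_; _++_; length; filter; map; concatMap; upTo; applyUpTo)
open import Data.List.Properties using (map-cong; map-upTo)
open import Data.List.Relation.Unary.All using (all?)
open import Data.Nat using (ℕ; zero; suc; pred; _+_; _≤_; _<_; _≥_; _<ᵇ_; _≤ᵇ_; _≡ᵇ_; s≤s; s≤s⁻¹; z<s)
open import Data.Nat.Combinatorics using (_C_; nC1≡n; nCk+nC[k+1]≡[n+1]C[k+1])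
open import Data.Nat.ListAction using (sum)
open import Data.Nat.Properties
  using ( _≟_; _≤?_; _<?_; +-suc; +-comm; +-monoʳ-≤; ≤-refl; ≤-trans; <-trans; <-≤-trans; <⇒≤; <⇒≢
        ; n≤1+n; m≤n+m; m≤n⇒m≤1+n; m<m+n; ≤∧≢⇒<; n≮n)
open import Data.List.Relation.Unary.Unique.DecPropositional _≟_ using (unique?)
open import Function using (_∘_)
open import Relation.Binary.PropositionalEquality
  using (_≡_; _≢_; refl; sym; trans; cong; cong₂; subst; module ≡-Reasoning)
open import Relation.Nullary using (does; ¬?; yes; no; contradiction)
open import Relation.Nullary.Decidable using (dec-true; dec-false)
open import Relation.Unary using (Decidable)

open ≡-Reasoning

private
  variable
    A : Set

count : (A → Bool) → List A → ℕ
count f [] = 0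
count f (x ∷ xs) = if f x then suc (count f xs) else count f xs

count-cong : ∀ {f g : A → Bool} → (∀ x → f x ≡ g x) → ∀ xs → count f xs ≡ count g xs
count-cong f≗g [] = refl
count-cong f≗g (x ∷ xs) rewrite f≗g x = cong (λ n → if _ then suc n else n) (count-cong f≗g xs)

count-false : ∀ (xs : List A) → count (λ _ → false) xs ≡ 0
count-false [] = refl
count-false (x ∷ xs) = count-false xs

count-guard : ∀ (g : Bool) (f : A → Bool) xs → count (λ x → g ∧ f x) xs ≡ (if g then count f xs else 0)
count-guard true f xs = refl
count-guard false f xs = count-false xs

count-++ : ∀ (f : A → Bool) xs ys → count f (xs ++ ys) ≡ count f xs + count f ys
count-++ f [] ys = refl
count-++ f (x ∷ xs) ys with f x
... | true = cong suc (count-++ f xs ys)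
... | false = count-++ f xs ys

count-map : ∀ {B : Set} (f : B → Bool) (g : A → B) xs → count f (map g xs) ≡ count (f ∘ g) xs
count-map f g [] = refl
count-map f g (x ∷ xs) = cong (λ n → if _ then suc n else n) (count-map f g xs)

count-concatMap : ∀ {B : Set} (f : B → Bool) (g : A → List B) xs →
  count f (concatMap g xs) ≡ sum (map (count f ∘ g) xs)
count-concatMap f g [] = refl
count-concatMap f g (x ∷ xs) = trans (count-++ f (g x) _) (cong (count f (g x) +_) (count-concatMap f g xs))

length-filter≡count : ∀ {P : A → Set} (P? : Decidable P) xs → length (filter P? xs) ≡ count (does ∘ P?) xs
length-filter≡count P? [] = refl
length-filter≡count P? (x ∷ xs) with does (P? x)
... | true = cong suc (length-filter≡count P? xs)
... | false = length-filter≡count P? xs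

count-filter : ∀ {P : A → Set} (P? : Decidable P) (f : A → Bool) xs →
  count f (filter P? xs) ≡ count (λ x → does (P? x) ∧ f x) xs
count-filter P? f [] = refl
count-filter P? f (x ∷ xs) with does (P? x)
... | true = cong (λ n → if f x then suc n else n) (count-filter P? f xs)
... | false = count-filter P? f xs

count-allSeqs-suc : ∀ (f : List ℕ → Bool) b k →
  count f (allSeqs b (suc k)) ≡ sum (applyUpTo (λ x → count (f ∘ (x ∷_)) (allSeqs b k)) b)
count-allSeqs-suc f b k = begin
  count f (allSeqs b (suc k))
    ≡⟨ count-concatMap f _ (upTo b) ⟩
  sum (map (λ x → count f (map (x ∷_) (allSeqs b k))) (upTo b))
    ≡⟨ cong sum (map-cong (λ x → count-map f (x ∷_) (allSeqs b k)) (upTo b)) ⟩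
  sum (map (λ x → count (f ∘ (x ∷_)) (allSeqs b k)) (upTo b))
    ≡⟨ cong sum (map-upTo _ b) ⟩
  sum (applyUpTo (λ x → count (f ∘ (x ∷_)) (allSeqs b k)) b) ∎

sum-applyUpTo-zero : ∀ {f : ℕ → ℕ} b → (∀ x → f x ≡ 0) → sum (applyUpTo f b) ≡ 0
sum-applyUpTo-zero zero f≡0 = refl
sum-applyUpTo-zero (suc b) f≡0 rewrite f≡0 0 = sum-applyUpTo-zero b (f≡0 ∘ suc)

sum-applyUpTo-single : ∀ {f : ℕ → ℕ} {a} b → a < b → (∀ x → x ≢ a → f x ≡ 0) →
  sum (applyUpTo f b) ≡ f a
sum-applyUpTo-single {f} {zero} (suc b) _ f≡0 =
  trans (cong (f 0 +_) (sum-applyUpTo-zero b (λ x → f≡0 (suc x) λ ()))) (+-comm (f 0) 0)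
sum-applyUpTo-single {f} {suc a} (suc b) (s≤s a<b) f≡0 rewrite f≡0 0 (λ ()) =
  sum-applyUpTo-single b a<b (λ x x≢a → f≡0 (suc x) (x≢a ∘ cong pred))

sum-applyUpTo-pair : ∀ {f : ℕ → ℕ} {a c} b → a < c → c < b → (∀ x → x ≢ a → x ≢ c → f x ≡ 0) →
  sum (applyUpTo f b) ≡ f a + f c
sum-applyUpTo-pair {f} {zero} {suc c} (suc b) _ (s≤s c<b) f≡0 =
  cong (f 0 +_) (sum-applyUpTo-single b c<b (λ x x≢c → f≡0 (suc x) (λ ()) (x≢c ∘ cong pred)))
sum-applyUpTo-pair {f} {suc a} {suc c} (suc b) (s≤s a<c) (s≤s c<b) f≡0 rewrite f≡0 0 (λ ()) (λ ()) =
  sum-applyUpTo-pair b a<c c<b (λ x x≢a x≢c → f≡0 (suc x) (x≢a ∘ cong pred) (x≢c ∘ cong pred))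

-- The automaton

lastOf : A → List A → A
lastOf x [] = x
lastOf x (y ∷ ys) = lastOf y ys

lastOf-∷ʳ : ∀ (x : A) xs y → lastOf x (xs ++ y ∷ []) ≡ y
lastOf-∷ʳ x [] y = refl
lastOf-∷ʳ x (x′ ∷ xs) y = lastOf-∷ʳ x′ xs y

asc-∷ʳ : ∀ x xs y → asc (x ∷ xs ++ y ∷ []) ≡ (if lastOf x xs <ᵇ y then suc (asc (x ∷ xs)) else asc (x ∷ xs))
asc-∷ʳ x [] y with x <ᵇ y
... | true = refl
... | false = refl
asc-∷ʳ x (x′ ∷ xs) y rewrite asc-∷ʳ x′ xs y with lastOf x′ xs <ᵇ y
... | true = +-suc _ _
... | false = refl

ascentsFrom : ℕ → ℕ → ℕ → List ℕ → Bool
ascentsFrom p a l [] = true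
ascentsFrom p a l (x ∷ xs) = (x ≤ᵇ p + a) ∧ ascentsFrom p (if l <ᵇ x then suc a else a) x xs

extend : (ℕ → Bool) → ℕ → ℕ → Bool
extend used x y = used y ∨ (x ≡ᵇ y)

freshFrom : (ℕ → Bool) → List ℕ → Bool
freshFrom used [] = true
freshFrom used (x ∷ xs) = not (used x) ∧ freshFrom (extend used x) xs

Continues : ℕ → ℕ → ℕ → (ℕ → Bool) → List ℕ → Bool
Continues p a l used xs = ascentsFrom p a l xs ∧ freshFrom used xs

ascOKFrom≡ascentsFrom : ∀ p x xs ys → ascOKFrom p (x ∷ xs) ys ≡ ascentsFrom p (asc (x ∷ xs)) (lastOf x xs) ys
ascOKFrom≡ascentsFrom p x xs [] = refl
ascOKFrom≡ascentsFrom p x xs (y ∷ ys) = cong ((y ≤ᵇ p + asc (x ∷ xs)) ∧_) (begin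
  ascOKFrom p (x ∷ xs ++ y ∷ []) ys
    ≡⟨ ascOKFrom≡ascentsFrom p x (xs ++ y ∷ []) ys ⟩
  ascentsFrom p (asc (x ∷ xs ++ y ∷ [])) (lastOf x (xs ++ y ∷ [])) ys
    ≡⟨ cong₂ (λ a l → ascentsFrom p a l ys) (asc-∷ʳ x xs y) (lastOf-∷ʳ x xs y) ⟩
  ascentsFrom p (if lastOf x xs <ᵇ y then suc (asc (x ∷ xs)) else asc (x ∷ xs)) y ys ∎)

not-∨ : ∀ b c → not (b ∨ c) ≡ not b ∧ not c
not-∨ true c = refl
not-∨ false c = refl

all-not-extend : ∀ used x ys →
  all (not ∘ extend used x) ys ≡ all (not ∘ used) ys ∧ does (all? (λ y → ¬? (x ≟ y)) ys)
all-not-extend used x [] = refl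
all-not-extend used x (y ∷ ys) = begin
  not (used y ∨ (x ≡ᵇ y)) ∧ all (not ∘ extend used x) ys
    ≡⟨ cong₂ _∧_ (not-∨ (used y) (x ≡ᵇ y)) (all-not-extend used x ys) ⟩
  (not (used y) ∧ not (x ≡ᵇ y)) ∧ (all (not ∘ used) ys ∧ fresh)
    ≡⟨ interchange (not (used y)) (not (x ≡ᵇ y)) (all (not ∘ used) ys) fresh ⟩
  (not (used y) ∧ all (not ∘ used) ys) ∧ (not (x ≡ᵇ y) ∧ fresh) ∎
  where
  fresh : Bool
  fresh = does (all? (λ y → ¬? (x ≟ y)) ys)

freshFrom≡all-unused∧unique : ∀ used xs → freshFrom used xs ≡ all (not ∘ used) xs ∧ does (unique? xs)
freshFrom≡all-unused∧unique used [] = refl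
freshFrom≡all-unused∧unique used (x ∷ xs) = begin
  not (used x) ∧ freshFrom (extend used x) xs
    ≡⟨ cong (not (used x) ∧_) (freshFrom≡all-unused∧unique (extend used x) xs) ⟩
  not (used x) ∧ (all (not ∘ extend used x) xs ∧ does (unique? xs))
    ≡⟨ cong (λ b → not (used x) ∧ (b ∧ does (unique? xs))) (all-not-extend used x xs) ⟩
  not (used x) ∧ ((all (not ∘ used) xs ∧ fresh) ∧ does (unique? xs))
    ≡⟨ cong (not (used x) ∧_) (∧-assoc (all (not ∘ used) xs) fresh (does (unique? xs))) ⟩
  not (used x) ∧ (all (not ∘ used) xs ∧ (fresh ∧ does (unique? xs)))
    ≡⟨ sym (∧-assoc (not (used x)) (all (not ∘ used) xs) _) ⟩
  (not (used x) ∧ all (not ∘ used) xs) ∧ (fresh ∧ does (unique? xs)) ∎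
  where
  fresh : Bool
  fresh = does (all? (λ y → ¬? (x ≟ y)) xs)

all-true : ∀ (xs : List A) → all (λ _ → true) xs ≡ true
all-true [] = refl
all-true (x ∷ xs) = all-true xs

unique?≡freshFrom-∅ : ∀ xs → does (unique? xs) ≡ freshFrom (λ _ → false) xs
unique?≡freshFrom-∅ xs =
  sym (trans (freshFrom≡all-unused∧unique (λ _ → false) xs) (cong (_∧ does (unique? xs)) (all-true xs)))

freshFrom-cong : ∀ {used used′} → (∀ y → used y ≡ used′ y) → ∀ xs → freshFrom used xs ≡ freshFrom used′ xs
freshFrom-cong same [] = refl
freshFrom-cong same (x ∷ xs) rewrite same x =
  cong (_ ∧_) (freshFrom-cong (λ y → cong (_∨ (x ≡ᵇ y)) (same y)) xs)

module _ {p a l : ℕ} {used : ℕ → Bool} {x : ℕ} (L : List (List ℕ)) where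

  count-Continues-∷ : count (Continues p a l used ∘ (x ∷_)) L ≡
    (if (x ≤ᵇ p + a) ∧ not (used x) then count (Continues p (if l <ᵇ x then suc a else a) x (extend used x)) L else 0)
  count-Continues-∷ = trans (count-cong (λ ys → interchange (x ≤ᵇ p + a) _ (not (used x)) _) L) (count-guard _ _ L)

  count-Continues-blocked : (x ≤ p + a → used x ≡ true) → count (Continues p a l used ∘ (x ∷_)) L ≡ 0
  count-Continues-blocked blocked rewrite count-Continues-∷ with x ≤? p + a
  ... | yes x≤p+a rewrite dec-true (x ≤? p + a) x≤p+a | blocked x≤p+a = refl
  ... | no x≰p+a rewrite dec-false (x ≤? p + a) x≰p+a = refl

  module _ {used′ : ℕ → Bool} (x≤p+a : x ≤ p + a) (x-fresh : used x ≡ false) (same : ∀ y → extend used x y ≡ used′ y) where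

    count-Continues-ascent : l < x → count (Continues p a l used ∘ (x ∷_)) L ≡ count (Continues p (suc a) x used′) L
    count-Continues-ascent l<x
      rewrite count-Continues-∷ | dec-true (x ≤? p + a) x≤p+a | x-fresh | dec-true (l <? x) l<x =
      count-cong (λ ys → cong (ascentsFrom p (suc a) x ys ∧_) (freshFrom-cong same ys)) L

    count-Continues-descent : x ≤ l → count (Continues p a l used ∘ (x ∷_)) L ≡ count (Continues p a x used′) L
    count-Continues-descent x≤l
      rewrite count-Continues-∷ | dec-true (x ≤? p + a) x≤p+a | x-fresh | dec-false (l <? x) (λ l<x → n≮n l (<-≤-trans l<x x≤l)) =
      count-cong (λ ys → cong (ascentsFrom p a x ys ∧_) (freshFrom-cong same ys)) L

-- Reachable states for p = 2

below : ℕ → ℕ → Bool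
below c y = y <ᵇ c

belowExcept : ℕ → ℕ → ℕ → Bool
belowExcept c m y = not (m ≡ᵇ y) ∧ (y <ᵇ c)

below-irrefl : ∀ c → below c c ≡ false
below-irrefl c = dec-false (c <? c) (n≮n c)

belowExcept-irrefl : ∀ c m → belowExcept c m c ≡ false
belowExcept-irrefl c m = trans (cong (not (m ≡ᵇ c) ∧_) (below-irrefl c)) (∧-zeroʳ _)

belowExcept-hole : ∀ c m → belowExcept c m m ≡ false
belowExcept-hole c m = cong (λ b → not b ∧ (m <ᵇ c)) (dec-true (m ≟ m) refl)

below-extend : ∀ c y → extend (below c) c y ≡ below (suc c) y
below-extend zero zero = refl
below-extend zero (suc y) = refl
below-extend (suc c) zero = refl
below-extend (suc c) (suc y) = below-extend c y

below-extend-suc : ∀ c y → extend (below c) (suc c) y ≡ belowExcept (2 + c) c y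
below-extend-suc zero zero = refl
below-extend-suc zero (suc zero) = refl
below-extend-suc zero (suc (suc y)) = refl
below-extend-suc (suc c) zero = refl
below-extend-suc (suc c) (suc y) = below-extend-suc c y

belowExcept-extend : ∀ {c m} → m ≢ c → ∀ y → extend (belowExcept c m) c y ≡ belowExcept (suc c) m y
belowExcept-extend {zero} {zero} m≢c y = contradiction refl m≢c
belowExcept-extend {zero} {suc m} m≢c zero = refl
belowExcept-extend {zero} {suc m} m≢c (suc y) = ∨-identityʳ _
belowExcept-extend {suc c} {zero} m≢c zero = refl
belowExcept-extend {suc c} {zero} m≢c (suc y) = below-extend c y
belowExcept-extend {suc c} {suc m} m≢c zero = refl
belowExcept-extend {suc c} {suc m} m≢c (suc y) = belowExcept-extend (m≢c ∘ cong suc) y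

belowExcept-fill : ∀ {c m} → m < c → ∀ y → extend (belowExcept c m) m y ≡ below c y
belowExcept-fill {suc c} {zero} _ zero = refl
belowExcept-fill {suc c} {zero} _ (suc y) = ∨-identityʳ (y <ᵇ c)
belowExcept-fill {suc c} {suc m} _ zero = refl
belowExcept-fill {suc c} {suc m} (s≤s m<c) (suc y) = belowExcept-fill m<c y

-- allSeqs b k offers only letters below b, and k letters appended in a state with a ascents stay ≤ a + 1 + k.
module _ {a k b : ℕ} (budget : 2 + a + suc k ≤ b) where

  top<bound : 2 + a < b
  top<bound = <-≤-trans (m<m+n (2 + a) z<s) budget

  budget-ascent : 2 + suc a + k ≤ b
  budget-ascent = subst (_≤ b) (+-suc (2 + a) k) budget

  budget-descent : 2 + a + k ≤ b
  budget-descent = ≤-trans (+-monoʳ-≤ (2 + a) (n≤1+n k)) budget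

extensions-saturated : ∀ k a l b → l ≤ suc a → 2 + a + k ≤ b →
  count (Continues 2 a l (below (2 + a))) (allSeqs b k) ≡ 1
extensions-saturated zero a l b _ _ = refl
extensions-saturated (suc k) a l b l≤1+a budget = begin
  count cont (allSeqs b (suc k))
    ≡⟨ count-allSeqs-suc cont b k ⟩
  sum (applyUpTo after b)
    ≡⟨ sum-applyUpTo-single b (top<bound budget) blocked ⟩
  after (2 + a)
    ≡⟨ count-Continues-ascent L ≤-refl (below-irrefl (2 + a)) (below-extend (2 + a)) (s≤s l≤1+a) ⟩
  count (Continues 2 (suc a) (2 + a) (below (3 + a))) L
    ≡⟨ extensions-saturated k (suc a) (2 + a) b ≤-refl (budget-ascent budget) ⟩
  1 ∎
  where
  cont : List ℕ → Bool
  cont = Continues 2 a l (below (2 + a))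
  L : List (List ℕ)
  L = allSeqs b k
  after : ℕ → ℕ
  after x = count (cont ∘ (x ∷_)) L
  blocked : ∀ x → x ≢ 2 + a → after x ≡ 0
  blocked x x≢2+a = count-Continues-blocked L (λ x≤2+a → dec-true (x <? 2 + a) (≤∧≢⇒< x≤2+a x≢2+a))

extensions-gap : ∀ k a m b → m ≤ a → 2 + a + k ≤ b →
  count (Continues 2 a (suc a) (belowExcept (2 + a) m)) (allSeqs b k) ≡ suc k
extensions-gap zero a m b _ _ = refl
extensions-gap (suc k) a m b m≤a budget = begin
  count cont (allSeqs b (suc k))
    ≡⟨ count-allSeqs-suc cont b k ⟩
  sum (applyUpTo after b)
    ≡⟨ sum-applyUpTo-pair b m<2+a (top<bound budget) blocked ⟩
  after m + after (2 + a)
    ≡⟨ cong₂ _+_ fill-gap extend-top ⟩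
  1 + suc k ∎
  where
  cont : List ℕ → Bool
  cont = Continues 2 a (suc a) (belowExcept (2 + a) m)
  L : List (List ℕ)
  L = allSeqs b k
  after : ℕ → ℕ
  after x = count (cont ∘ (x ∷_)) L
  m≤1+a : m ≤ suc a
  m≤1+a = m≤n⇒m≤1+n m≤a
  m<2+a : m < 2 + a
  m<2+a = s≤s m≤1+a
  fill-gap : after m ≡ 1
  fill-gap = begin
    after m
      ≡⟨ count-Continues-descent L (<⇒≤ m<2+a) (belowExcept-hole (2 + a) m) (belowExcept-fill m<2+a) m≤1+a ⟩
    count (Continues 2 a m (below (2 + a))) L
      ≡⟨ extensions-saturated k a m b m≤1+a (budget-descent budget) ⟩
    1 ∎
  extend-top : after (2 + a) ≡ suc k
  extend-top = begin
    after (2 + a)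
      ≡⟨ count-Continues-ascent L ≤-refl (belowExcept-irrefl (2 + a) m) (belowExcept-extend (<⇒≢ m<2+a)) ≤-refl ⟩
    count (Continues 2 (suc a) (2 + a) (belowExcept (3 + a) m)) L
      ≡⟨ extensions-gap k (suc a) m b (m≤n⇒m≤1+n m≤a) (budget-ascent budget) ⟩
    suc k ∎
  blocked : ∀ x → x ≢ m → x ≢ 2 + a → after x ≡ 0
  blocked x x≢m x≢2+a = count-Continues-blocked L (λ x≤2+a →
    cong₂ (λ e c → not e ∧ c) (dec-false (m ≟ x) (x≢m ∘ sym)) (dec-true (x <? 2 + a) (≤∧≢⇒< x≤2+a x≢2+a)))

C2-suc : ∀ n → n C 2 + n ≡ suc n C 2
C2-suc n = begin
  n C 2 + n      ≡⟨ +-comm (n C 2) n ⟩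
  n + n C 2      ≡⟨ cong (_+ n C 2) (sym (nC1≡n n)) ⟩
  n C 1 + n C 2  ≡⟨ nCk+nC[k+1]≡[n+1]C[k+1] n 1 ⟩
  suc n C 2      ∎

extensions-interval : ∀ k a b → 2 + a + k ≤ b →
  count (Continues 2 a a (below (suc a))) (allSeqs b k) ≡ 1 + suc k C 2
extensions-interval zero a b _ = refl
extensions-interval (suc k) a b budget = begin
  count cont (allSeqs b (suc k))
    ≡⟨ count-allSeqs-suc cont b k ⟩
  sum (applyUpTo after b)
    ≡⟨ sum-applyUpTo-pair b ≤-refl (top<bound budget) blocked ⟩
  after (suc a) + after (2 + a)
    ≡⟨ cong₂ _+_ extend-next extend-skip ⟩
  1 + suc k C 2 + suc k
    ≡⟨ cong suc (C2-suc (suc k)) ⟩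
  1 + suc (suc k) C 2 ∎
  where
  cont : List ℕ → Bool
  cont = Continues 2 a a (below (suc a))
  L : List (List ℕ)
  L = allSeqs b k
  after : ℕ → ℕ
  after x = count (cont ∘ (x ∷_)) L
  extend-next : after (suc a) ≡ 1 + suc k C 2
  extend-next = begin
    after (suc a)
      ≡⟨ count-Continues-ascent L (n≤1+n _) (below-irrefl (suc a)) (below-extend (suc a)) ≤-refl ⟩
    count (Continues 2 (suc a) (suc a) (below (2 + a))) L
      ≡⟨ extensions-interval k (suc a) b (budget-ascent budget) ⟩
    1 + suc k C 2 ∎
  extend-skip : after (2 + a) ≡ suc k
  extend-skip = begin
    after (2 + a)
      ≡⟨ count-Continues-ascent L ≤-refl (dec-false (2 + a <? suc a) (n≮n (suc a) ∘ <-trans ≤-refl))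
           (below-extend-suc (suc a)) (n≤1+n _) ⟩
    count (Continues 2 (suc a) (2 + a) (belowExcept (3 + a) (suc a))) L
      ≡⟨ extensions-gap k (suc a) (suc a) b ≤-refl (budget-ascent budget) ⟩
    suc k ∎
  blocked : ∀ x → x ≢ suc a → x ≢ 2 + a → after x ≡ 0
  blocked x x≢1+a x≢2+a = count-Continues-blocked L (λ x≤2+a →
    dec-true (x <? suc a) (≤∧≢⇒< (s≤s⁻¹ (≤∧≢⇒< x≤2+a x≢2+a)) x≢1+a))

does-isAscentSeq?-0∷ : ∀ p ys → does (isAscentSeq? p (0 ∷ ys)) ≡ ascOKFrom p (0 ∷ []) ys
does-isAscentSeq?-0∷ p ys with ascOKFrom p (0 ∷ []) ys
... | true = refl
... | false = refl

extend-∅-0 : ∀ y → extend (λ _ → false) 0 y ≡ below 1 y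
extend-∅-0 zero = refl
extend-∅-0 (suc y) = refl

distinctAscent-0∷≡Continues : ∀ p ys → does (isAscentSeq? p (0 ∷ ys)) ∧ does (unique? (0 ∷ ys)) ≡ Continues p 0 0 (below 1) ys
distinctAscent-0∷≡Continues p ys = cong₂ _∧_
  (trans (does-isAscentSeq?-0∷ p ys) (ascOKFrom≡ascentsFrom p 0 [] ys))
  (trans (unique?≡freshFrom-∅ (0 ∷ ys)) (freshFrom-cong extend-∅-0 ys))

a00≡count-Continues : ∀ m p → a00 (suc m) p ≡ count (Continues p 0 0 (below 1)) (allSeqs (p + suc m) m)
a00≡count-Continues m p = begin
  length (filter unique? (filter (isAscentSeq? p) (allSeqs b (suc m))))
    ≡⟨ length-filter≡count unique? (filter (isAscentSeq? p) (allSeqs b (suc m))) ⟩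
  count (does ∘ unique?) (filter (isAscentSeq? p) (allSeqs b (suc m)))
    ≡⟨ count-filter (isAscentSeq? p) _ (allSeqs b (suc m)) ⟩
  count distinctAscent (allSeqs b (suc m))
    ≡⟨ count-allSeqs-suc distinctAscent b m ⟩
  sum (applyUpTo (λ x → count (distinctAscent ∘ (x ∷_)) (allSeqs b m)) b)
    ≡⟨ sum-applyUpTo-single b (<-≤-trans z<s (m≤n+m (suc m) p)) nonzero-first ⟩
  count (distinctAscent ∘ (0 ∷_)) (allSeqs b m)
    ≡⟨ count-cong (distinctAscent-0∷≡Continues p) (allSeqs b m) ⟩
  count (Continues p 0 0 (below 1)) (allSeqs b m) ∎
  where
  b : ℕ
  b = p + suc m
  distinctAscent : List ℕ → Bool
  distinctAscent xs = does (isAscentSeq? p xs) ∧ does (unique? xs)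
  nonzero-first : ∀ x → x ≢ 0 → count (distinctAscent ∘ (x ∷_)) (allSeqs b m) ≡ 0
  nonzero-first zero x≢0 = contradiction refl x≢0
  nonzero-first (suc x) _ = count-false (allSeqs b m)

theorem4p1 : (n : ℕ) → n ≥ 1 → a00 n 2 ≡ 1 + n C 2
theorem4p1 (suc m) _ = begin
  a00 (suc m) 2                                               ≡⟨ a00≡count-Continues m 2 ⟩
  count (Continues 2 0 0 (below 1)) (allSeqs (2 + suc m) m)  ≡⟨ extensions-interval m 0 (2 + suc m) (+-monoʳ-≤ 2 (n≤1+n m)) ⟩
  1 + suc m C 2                                               ∎
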